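{- Let $C_n$ be a cycle that admits a weak IASI and let $P_m$ be a path. Then the sparing number of the graph $C_n\cup P_m$ is $0$ or $1$.
   Context: All graphs are simple and finite, with no isolated vertices; $\mathbb{N}_0$ denotes the set of non-negative integers. For $A,B\subseteq\mathbb{N}_0$, $A+B=\{a+b: a\in A, b\in B\}$. An integer additive set-indexer (IASI) of a graph $G$ is an injective function $f:V(G)\to 2^{\mathbb{N}_0}$ such that the induced function $g_f:E(G)\to 2^{\mathbb{N}_0}$, $g_f(uv)=f(u)+f(v)$, is also injective. An IASI $f$ is a weak IASI if $|g_f(uv)|=\max(|f(u)|,|f(v)|)$ for every edge $uv$. An element (vertex or edge) whose set-label has cardinality $1$ is called mono-indexed. The sparing number $\varphi(G)$ of a graph $G$ is the minimum number of mono-indexed edges required for $G$ to admit a weak IASI. -}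

module Defs where

open import Data.Nat using (ℕ; zero; suc; _+_; _≤_; _⊔_; _≟_)
open import Data.Nat.DivMod using (_mod_)
open import Data.Fin using (Fin; toℕ; inject₁; _↑ˡ_; _↑ʳ_)
open import Data.Product using (Σ; _×_; _,_; proj₁; proj₂)
open import Data.List using (List; []; _∷_; length; map; concatMap; deduplicate; filter; allFin; lookup; _++_)
open import Data.List.Membership.Propositional using (_∈_)
open import Data.List.Relation.Unary.Unique.Propositional using (Unique)
open import Function.Bundles using (_⇔_)
open import Relation.Binary.PropositionalEquality using (_≡_; _≢_)

-- A finite simple graph on the vertex set Fin N, given by its list of edges
-- (each edge listed once, as an ordered pair of its two end vertices).
record Graph : Set where
  field
    N     : ℕ
    edges : List (Fin N × Fin N)
open Graph public

-- A set-label: a finite nonempty subset of ℕ₀, represented by a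
-- duplicate-free list of its elements (order irrelevant).
Label : Set
Label = List ℕ

_≋_ : Label → Label → Set
A ≋ B = ∀ x → (x ∈ A) ⇔ (x ∈ B)

-- cardinality of a set-label (meaningful for duplicate-free lists)
∣_∣ : Label → ℕ
∣ A ∣ = length A

_⊕_ : Label → Label → Label
A ⊕ B = deduplicate _≟_ (concatMap (λ a → map (a +_) B) A)

edge : (G : Graph) → Fin (length (edges G)) → Fin (N G) × Fin (N G)
edge G i = lookup (edges G) i

gf : (G : Graph) → (Fin (N G) → Label) → Fin (length (edges G)) → Label
gf G f i = f (proj₁ (edge G i)) ⊕ f (proj₂ (edge G i))

-- integer additive set-indexer: injective f (into finite nonempty subsets
-- of ℕ₀) with injective induced edge function g_f
record IASI (G : Graph) (f : Fin (N G) → Label) : Set where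
  field
    nonempty  : ∀ v → f v ≢ []
    finiteSet : ∀ v → Unique (f v)
    f-inj     : ∀ u v → f u ≋ f v → u ≡ v
    g-inj     : ∀ i j → gf G f i ≋ gf G f j → i ≡ j

record WeakIASI (G : Graph) (f : Fin (N G) → Label) : Set where
  field
    iasi : IASI G f
    weak : ∀ i → ∣ gf G f i ∣ ≡ ∣ f (proj₁ (edge G i)) ∣ ⊔ ∣ f (proj₂ (edge G i)) ∣

monoEdges : (G : Graph) → (Fin (N G) → Label) → ℕ
monoEdges G f = length (filter (λ i → ∣ gf G f i ∣ ≟ 1) (allFin (length (edges G))))

AdmitsWeakIASI : Graph → Set
AdmitsWeakIASI G = Σ (Fin (N G) → Label) (λ f → WeakIASI G f)

SparingNumber : Graph → ℕ → Set
SparingNumber G k =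
  Σ (Fin (N G) → Label) (λ f → WeakIASI G f × monoEdges G f ≡ k)
  × (∀ f → WeakIASI G f → k ≤ monoEdges G f)

cycleEdges : (n : ℕ) → List (Fin n × Fin n)
cycleEdges zero    = []
cycleEdges (suc k) = map (λ i → i , (suc (toℕ i) mod suc k)) (allFin (suc k))

Cycle : ℕ → Graph
Cycle n = record { N = n ; edges = cycleEdges n }

pathEdges : (m : ℕ) → List (Fin m × Fin m)
pathEdges zero    = []
pathEdges (suc k) = map (λ i → inject₁ i , Fin.suc i) (allFin k)
  where import Data.Fin as Fin

Path : ℕ → Graph
Path m = record { N = m ; edges = pathEdges m }

_∪_ : Graph → Graph → Graph
G ∪ H = record
  { N     = N G + N H
  ; edges = map (λ e → (proj₁ e ↑ˡ N H) , (proj₂ e ↑ˡ N H)) (edges G)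
         ++ map (λ e → (N G ↑ʳ proj₁ e) , (N G ↑ʳ proj₂ e)) (edges H)
  }

module Submission where

-- General facts come first.  (1) Sumset growth: if |A|, |B| ≥ 2 then
-- |A + B| > max(|A|, |B|), so in a weak IASI every edge has a mono-indexed end,
-- and across an edge that is not mono-indexed exactly one end is mono-indexed.
-- (2) Consequently, along a closed walk of odd length some edge must be
-- mono-indexed, since otherwise the mono status of the vertices would alternate
-- an odd number of times and yet return to its starting value.
-- Then, for G = C_n ∪ P_m with vertices numbered 0, …, n-1 on the cycle and
-- n, …, n+m-1 on the path, (2) applied to the cycle gives φ(G) ≥ 1 for odd n.
-- (3) For the upper bound vertex j gets {w j} if j is even and {w j, w j + 1} if
-- j is odd, where w 0 = 1 and w j = 2j.  Adjacent vertices are never both odd,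
-- so each edge label is {s} or {s, s + 1} with s the sum of the end weights; these
-- sums are distinct (this needs n ≥ 3), giving a weak IASI whose only possible
-- mono-indexed edge is the closing edge (n-1, 0) of the cycle, mono-indexed
-- exactly when n is odd.

open import Defs
open import Data.Nat using (ℕ; zero; suc; _+_; _*_; _≤_; _<_; _⊔_; _≟_; _%_; _≤?_; z≤n; s≤s)
open import Data.Nat.Properties
open import Data.Nat.DivMod using (_mod_; m<n⇒m%n≡m; n%n≡0)
open import Data.Bool using (Bool; true; false; not; _∧_; _∨_; _xor_)
open import Data.Bool.Properties using (not-¬; not-distribˡ-xor; ∧-inverseʳ; ∧-zeroʳ; ∨-inverseʳ; ∨-identityʳ)
import Data.Fin as Fin
open import Data.Fin using (Fin; toℕ; fromℕ<; inject₁; _↑ˡ_; _↑ʳ_)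
open import Data.Fin.Properties using (toℕ-injective; toℕ-fromℕ<; toℕ-↑ˡ; toℕ-↑ʳ; toℕ-inject₁; toℕ<n)
open import Data.Product using (Σ; ∃₂; _×_; _,_; proj₁; proj₂)
open import Data.Sum using (_⊎_; inj₁; inj₂)
open import Data.Unit using (⊤; tt)
open import Data.Empty using (⊥-elim)
open import Data.List using (List; []; _∷_; length; map; tabulate; deduplicate; allFin; lookup; _++_)
open import Data.List.Properties using (length-map; length-++; length-tabulate; length-++-sucʳ; filter-none; filter-accept)
open import Data.List.Extrema.Nat using (max; argmax-sel; ⊥≤max; xs≤max)
open import Data.List.Membership.Propositional using (_∈_; find)
open import Data.List.Membership.Propositional.Properties
  using (∈-deduplicate⁺; ∈-deduplicate⁻; ∈-concatMap⁺; ∈-concatMap⁻; ∈-map⁺; ∈-map⁻; ∈-∃++; ∈-++⁺ˡ; ∈-++⁺ʳ; ∈-++⁻; ∈-filter⁺; ∈-allFin; ∈-length)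
open import Data.List.Relation.Unary.Any as Any using (here; there)
open import Data.List.Relation.Unary.All as All using (All; []; _∷_)
open import Data.List.Relation.Unary.All.Properties using (all-filter)
open import Data.List.Relation.Unary.AllPairs using ([]; _∷_)
open import Data.List.Relation.Unary.Unique.Propositional using (Unique)
import Data.List.Relation.Unary.Unique.Propositional.Properties as Unique
open import Data.List.Relation.Unary.Unique.DecPropositional.Properties _≟_ using (deduplicate-!)
open import Function using (_∘_; id)
open import Function.Bundles using (Equivalence)
open import Relation.Nullary using (¬_; ¬?; yes; no; does)
open import Relation.Nullary.Decidable using (dec-true; dec-false)
open import Relation.Binary.Definitions using (tri<; tri≈; tri>)
open import Relation.Binary.PropositionalEquality using (_≡_; _≢_; refl; sym; trans; cong; cong₂; subst; subst₂; module ≡-Reasoning)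

unique-⊆⇒length-≤ : {A : Set} {xs ys : List A} → Unique xs → (∀ {x} → x ∈ xs → x ∈ ys) → length xs ≤ length ys
unique-⊆⇒length-≤ {xs = []} _ _ = z≤n
unique-⊆⇒length-≤ {xs = x ∷ xs} {ys} (x∉xs ∷ uxs) xs⊆ys with ∈-∃++ (xs⊆ys (here refl))
... | us , vs , refl = ≤-trans (s≤s (unique-⊆⇒length-≤ uxs xs⊆us++vs)) (≤-reflexive (sym (length-++-sucʳ us x vs)))
  where
  -- removing the occurrence of x from ys still leaves room for the rest of xs
  xs⊆us++vs : ∀ {z} → z ∈ xs → z ∈ us ++ vs
  xs⊆us++vs {z} z∈xs with ∈-++⁻ us (xs⊆ys (there z∈xs))
  ... | inj₁ z∈us = ∈-++⁺ˡ z∈us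
  ... | inj₂ (here z≡x) = ⊥-elim (All.lookup x∉xs z∈xs (sym z≡x))
  ... | inj₂ (there z∈vs) = ∈-++⁺ʳ us z∈vs

maximum-∈ : ∀ a as → max a as ∈ a ∷ as
maximum-∈ a as with argmax-sel id a as
... | inj₁ top≡a = here top≡a
... | inj₂ top∈as = there top∈as

≤-maximum : ∀ {x} a as → x ∈ a ∷ as → x ≤ max a as
≤-maximum a as (here refl) = ⊥≤max a as
≤-maximum a as (there x∈as) = All.lookup (xs≤max a as) x∈as

two-distinct : ∀ {B : List ℕ} → Unique B → 2 ≤ length B → ∃₂ λ b b' → b ∈ B × b' ∈ B × b < b'
two-distinct {x ∷ y ∷ _} ((x≢y ∷ _) ∷ _) _ with <-cmp x y
... | tri< x<y _ _ = x , y , here refl , there (here refl) , x<y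
... | tri≈ _ x≡y _ = ⊥-elim (x≢y x≡y)
... | tri> _ _ y<x = y , x , there (here refl) , here refl , y<x
two-distinct {_ ∷ []} _ (s≤s ())

∈-⊕⁺ : ∀ {A B a b} → a ∈ A → b ∈ B → a + b ∈ A ⊕ B
∈-⊕⁺ {A} {B} a∈A b∈B =
  ∈-deduplicate⁺ _≟_ (∈-concatMap⁺ (λ a → map (a +_) B) (Any.map (λ { refl → ∈-map⁺ (_ +_) b∈B }) a∈A))

∈-⊕⁻ : ∀ {A B x} → x ∈ A ⊕ B → ∃₂ λ a b → a ∈ A × b ∈ B × x ≡ a + b
∈-⊕⁻ {A} {B} x∈A⊕B with find (∈-concatMap⁻ (λ a → map (a +_) B) {xs = A} (∈-deduplicate⁻ _≟_ _ x∈A⊕B))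
... | a , a∈A , x∈a+B with ∈-map⁻ (a +_) x∈a+B
... | b , b∈B , x≡a+b = a , b , a∈A , b∈B , x≡a+b

⊕-comm-⊆ : ∀ {A B x} → x ∈ A ⊕ B → x ∈ B ⊕ A
⊕-comm-⊆ {A} {B} x∈A⊕B with ∈-⊕⁻ {A} {B} x∈A⊕B
... | a , b , a∈A , b∈B , refl = subst (_∈ B ⊕ A) (+-comm b a) (∈-⊕⁺ b∈B a∈A)

-- Adding a set with two elements b < b' to a nonempty set A gains an element:
-- the sums a + b (a ∈ A) are distinct and all smaller than (max A) + b'.
⊕-grows : ∀ {A B} → Unique A → 1 ≤ length A → Unique B → 2 ≤ length B → length A < length (A ⊕ B)
⊕-grows {a ∷ as} {B} uA _ uB 2≤∣B∣ with two-distinct uB 2≤∣B∣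
... | b , b' , b∈B , b'∈B , b<b' =
  subst (_≤ length ((a ∷ as) ⊕ B)) (cong suc (length-map (_+ b) (a ∷ as))) (unique-⊆⇒length-≤ uS S⊆A⊕B)
  where
  top = max a as
  S = top + b' ∷ map (_+ b) (a ∷ as)
  top+b'-new : All (top + b' ≢_) (map (_+ b) (a ∷ as))
  top+b'-new = All.tabulate λ z∈ → larger (∈-map⁻ (_+ b) z∈)
    where
    larger : ∀ {z} → Σ ℕ (λ x → x ∈ a ∷ as × z ≡ x + b) → top + b' ≢ z
    larger (x , x∈A , refl) top+b'≡x+b = <-irrefl (sym top+b'≡x+b) (+-mono-≤-< (≤-maximum a as x∈A) b<b')
  uS : Unique S
  uS = top+b'-new ∷ Unique.map⁺ (λ {x} {y} → +-cancelʳ-≡ b x y) uA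
  S⊆A⊕B : ∀ {z} → z ∈ S → z ∈ (a ∷ as) ⊕ B
  S⊆A⊕B (here refl) = ∈-⊕⁺ (maximum-∈ a as) b'∈B
  S⊆A⊕B (there z∈) with ∈-map⁻ (_+ b) z∈
  ... | x , x∈A , refl = ∈-⊕⁺ x∈A b∈B

⊕-exceeds-max : ∀ {A B} → Unique A → Unique B → 2 ≤ length A → 2 ≤ length B → length A ⊔ length B < length (A ⊕ B)
⊕-exceeds-max {A} {B} uA uB 2≤∣A∣ 2≤∣B∣ = ⊔-lub
  (⊕-grows uA (<⇒≤ 2≤∣A∣) uB 2≤∣B∣)
  (≤-trans (⊕-grows uB (<⇒≤ 2≤∣B∣) uA 2≤∣A∣) (unique-⊆⇒length-≤ (deduplicate-! _) (⊕-comm-⊆ {B} {A})))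

Mono : Label → Set
Mono A = ∣ A ∣ ≡ 1

src tgt : (G : Graph) → Fin (length (edges G)) → Fin (N G)
src G i = proj₁ (edge G i)
tgt G i = proj₂ (edge G i)

Joins : (G : Graph) → Fin (N G) → Fin (N G) → Set
Joins G u v = Σ (Fin (length (edges G))) λ i → src G i ≡ u × tgt G i ≡ v

odd : ℕ → Bool
odd zero = false
odd (suc j) = not (odd j)

module _ {G : Graph} {f : Fin (N G) → Label} (weakIASI : WeakIASI G f) where
  open WeakIASI weakIASI
  open IASI iasi

  1≤∣f∣ : ∀ v → 1 ≤ ∣ f v ∣
  1≤∣f∣ v with f v | nonempty v
  ... | [] | f≢[] = ⊥-elim (f≢[] refl)
  ... | _ ∷ _ | _ = s≤s z≤n

  -- Every edge has a mono-indexed end: if both end labels had two or more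
  -- elements, their sumset would be larger than the weak condition allows.
  edge-has-mono-end : ∀ i → Mono (f (src G i)) ⊎ Mono (f (tgt G i))
  edge-has-mono-end i with ∣ f (src G i) ∣ ≟ 1 | ∣ f (tgt G i) ∣ ≟ 1
  ... | yes monoU | _ = inj₁ monoU
  ... | no _ | yes monoV = inj₂ monoV
  ... | no ¬monoU | no ¬monoV = ⊥-elim (<-irrefl (sym (weak i))
        (⊕-exceeds-max (finiteSet _) (finiteSet _) (at-least-two _ ¬monoU) (at-least-two _ ¬monoV)))
    where
    at-least-two : ∀ v → ¬ Mono (f v) → 2 ≤ ∣ f v ∣
    at-least-two v ¬mono = ≤∧≢⇒< (1≤∣f∣ v) (¬mono ∘ sym)

  mono-ends⇒mono-edge : ∀ i → Mono (f (src G i)) → Mono (f (tgt G i)) → Mono (gf G f i)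
  mono-ends⇒mono-edge i monoU monoV = trans (weak i) (cong₂ _⊔_ monoU monoV)

  isMono : Fin (N G) → Bool
  isMono v = does (∣ f v ∣ ≟ 1)

  non-mono-edge-alternates : ∀ i → ¬ Mono (gf G f i) → isMono (tgt G i) ≡ not (isMono (src G i))
  non-mono-edge-alternates i ¬mono with edge-has-mono-end i
  ... | inj₁ monoU = trans (dec-false (∣ f (tgt G i) ∣ ≟ 1) (¬mono ∘ mono-ends⇒mono-edge i monoU))
                           (cong not (sym (dec-true (∣ f (src G i) ∣ ≟ 1) monoU)))
  ... | inj₂ monoV = trans (dec-true (∣ f (tgt G i) ∣ ≟ 1) monoV)
                           (cong not (sym (dec-false (∣ f (src G i) ∣ ≟ 1) (λ monoU → ¬mono (mono-ends⇒mono-edge i monoU monoV)))))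

  -- A closed walk of odd length L forces a mono-indexed edge: without one, the
  -- mono status alternates along the walk, so after L steps it has flipped.
  odd-closed-walk-forces-mono-edge : (walk : ℕ → Fin (N G)) (L : ℕ) → odd L ≡ true → walk L ≡ walk 0 →
    (∀ j → j < L → Joins G (walk j) (walk (suc j))) → ¬ (∀ i → ¬ Mono (gf G f i))
  odd-closed-walk-forces-mono-edge walk L oddL closed joined noMono =
    not-¬ refl (trans (cong isMono (sym closed)) (trans (alternation L ≤-refl) (cong (_xor isMono (walk 0)) oddL)))
    where
    open ≡-Reasoning
    alternation : ∀ j → j ≤ L → isMono (walk j) ≡ odd j xor isMono (walk 0)
    alternation zero _ = refl
    alternation (suc j) j<L with joined j j<L
    ... | i , src≡walk-j , tgt≡walk-sj = begin
      isMono (walk (suc j))                ≡⟨ cong isMono tgt≡walk-sj ⟨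
      isMono (tgt G i)                     ≡⟨ non-mono-edge-alternates i (noMono i) ⟩
      not (isMono (src G i))               ≡⟨ cong (not ∘ isMono) src≡walk-j ⟩
      not (isMono (walk j))                ≡⟨ cong not (alternation j (<⇒≤ j<L)) ⟩
      not (odd j xor isMono (walk 0))      ≡⟨ not-distribˡ-xor (odd j) (isMono (walk 0)) ⟩
      odd (suc j) xor isMono (walk 0)      ∎

mono-edge⇒1≤monoEdges : ∀ G f i → Mono (gf G f i) → 1 ≤ monoEdges G f
mono-edge⇒1≤monoEdges G f i mono = ∈-length (∈-filter⁺ (λ i → ∣ gf G f i ∣ ≟ 1) (∈-allFin i) mono)

forced-mono-edge⇒1≤monoEdges : ∀ G f → ¬ (∀ i → ¬ Mono (gf G f i)) → 1 ≤ monoEdges G f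
forced-mono-edge⇒1≤monoEdges G f forced with 1 ≤? monoEdges G f
... | yes 1≤count = 1≤count
... | no ¬1≤count = ⊥-elim (forced λ i mono → ¬1≤count (mono-edge⇒1≤monoEdges G f i mono))

no-mono-edge⇒monoEdges≡0 : ∀ G f → (∀ i → ¬ Mono (gf G f i)) → monoEdges G f ≡ 0
no-mono-edge⇒monoEdges≡0 G f noMono =
  cong length (filter-none (λ i → ∣ gf G f i ∣ ≟ 1) {xs = allFin _} (All.tabulate λ {i} _ → noMono i))

mono-edges-at-one-position⇒monoEdges≤1 : ∀ G f c → (∀ i → Mono (gf G f i) → toℕ i ≡ c) → monoEdges G f ≤ 1
mono-edges-at-one-position⇒monoEdges≤1 G f c atC = unique-at-c
  (Unique.filter⁺ (λ i → ∣ gf G f i ∣ ≟ 1) (Unique.allFin⁺ _))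
  (All.map (λ {i} → atC i) (all-filter (λ i → ∣ gf G f i ∣ ≟ 1) (allFin _)))
  where
  unique-at-c : ∀ {xs : List (Fin (length (edges G)))} → Unique xs → All (λ i → toℕ i ≡ c) xs → length xs ≤ 1
  unique-at-c {[]} _ _ = z≤n
  unique-at-c {_ ∷ []} _ _ = s≤s z≤n
  unique-at-c {_ ∷ _ ∷ _} ((i≢j ∷ _) ∷ _) (i≡c ∷ j≡c ∷ _) = ⊥-elim (i≢j (toℕ-injective (trans i≡c (sym j≡c))))

-- `AtPositions Q o xs`: the entry of xs at position p satisfies Q (o + p).  It lets
-- us read off the edge at each position of an edge list built by map, tabulate and ++.
AtPositions : {E : Set} → (ℕ → E → Set) → ℕ → List E → Set
AtPositions Q o [] = ⊤
AtPositions Q o (e ∷ es) = Q o e × AtPositions Q (suc o) es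

module _ {E : Set} {Q : ℕ → E → Set} where

  lookup-atPositions : ∀ {o} xs → AtPositions Q o xs → ∀ i → Q (o + toℕ i) (lookup xs i)
  lookup-atPositions {o} (x ∷ xs) (qx , _) Fin.zero = subst (λ p → Q p x) (sym (+-identityʳ o)) qx
  lookup-atPositions {o} (x ∷ xs) (_ , qxs) (Fin.suc i) =
    subst (λ p → Q p (lookup xs i)) (sym (+-suc o (toℕ i))) (lookup-atPositions xs qxs i)

  atPositions-++ : ∀ {o} xs {ys} → AtPositions Q o xs → AtPositions Q (o + length xs) ys → AtPositions Q o (xs ++ ys)
  atPositions-++ {o} [] {ys} _ qys = subst (λ p → AtPositions Q p ys) (+-identityʳ o) qys
  atPositions-++ {o} (x ∷ xs) {ys} (qx , qxs) qys =
    qx , atPositions-++ xs qxs (subst (λ p → AtPositions Q p ys) (+-suc o (length xs)) qys)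

  atPositions-tabulate : ∀ {o n} (h : Fin n → E) → (∀ i → Q (o + toℕ i) (h i)) → AtPositions Q o (tabulate h)
  atPositions-tabulate {o} {zero} h _ = tt
  atPositions-tabulate {o} {suc n} h qh =
    subst (λ p → Q p (h Fin.zero)) (+-identityʳ o) (qh Fin.zero) ,
    atPositions-tabulate (h ∘ Fin.suc) λ i → subst (λ p → Q p (h (Fin.suc i))) (+-suc o (toℕ i)) (qh (Fin.suc i))

atPositions-map : ∀ {A E : Set} {Q : ℕ → E → Set} {o} (h : A → E) xs →
  AtPositions (λ p a → Q p (h a)) o xs → AtPositions Q o (map h xs)
atPositions-map h [] _ = tt
atPositions-map h (x ∷ xs) (qx , qxs) = qx , atPositions-map h xs qxs

lab : Bool → ℕ → Label
lab true x = x ∷ suc x ∷ []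
lab false x = x ∷ []

lab-nonempty : ∀ c x → lab c x ≢ []
lab-nonempty true x ()
lab-nonempty false x ()

lab-unique : ∀ c x → Unique (lab c x)
lab-unique true x = ((<⇒≢ (n<1+n x)) ∷ []) ∷ [] ∷ []
lab-unique false x = [] ∷ []

lab-mono⇒false : ∀ c x → Mono (lab c x) → c ≡ false
lab-mono⇒false false x _ = refl

lab-≋⇒base≡ : ∀ {c d x y} → lab c x ≋ lab d y → x ≡ y
lab-≋⇒base≡ {c} {d} {x} {y} same = squeeze (within d y (Equivalence.to (same x) (base-∈ c x)))
                                           (within c x (Equivalence.from (same y) (base-∈ d y)))
  where
  base-∈ : ∀ c x → x ∈ lab c x
  base-∈ true x = here refl
  base-∈ false x = here refl
  within : ∀ c x {z} → z ∈ lab c x → z ≡ x ⊎ z ≡ suc x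
  within true x (here z≡x) = inj₁ z≡x
  within true x (there (here z≡sx)) = inj₂ z≡sx
  within false x (here z≡x) = inj₁ z≡x
  squeeze : x ≡ y ⊎ x ≡ suc y → y ≡ x ⊎ y ≡ suc x → x ≡ y
  squeeze (inj₁ x≡y) _ = x≡y
  squeeze (inj₂ _) (inj₁ y≡x) = sym y≡x
  squeeze (inj₂ x≡sy) (inj₂ y≡sx) = ⊥-elim (<-asym (≤-reflexive (sym x≡sy)) (≤-reflexive (sym y≡sx)))

deduplicate-distinct-pair : ∀ {p q} → p ≢ q → deduplicate _≟_ (p ∷ q ∷ []) ≡ p ∷ q ∷ []
deduplicate-distinct-pair p≢q = cong (_ ∷_) (filter-accept (¬? ∘ (_ ≟_)) p≢q)

⊕-lab : ∀ c d x y → c ∧ d ≡ false → lab c x ⊕ lab d y ≡ lab (c ∨ d) (x + y)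
⊕-lab true true x y ()
⊕-lab true false x y _ = deduplicate-distinct-pair (<⇒≢ (n<1+n (x + y)))
⊕-lab false true x y _ = begin
  deduplicate _≟_ (x + y ∷ x + suc y ∷ [])  ≡⟨ deduplicate-distinct-pair (<⇒≢ (≤-reflexive (sym (+-suc x y)))) ⟩
  x + y ∷ x + suc y ∷ []                    ≡⟨ cong (λ z → x + y ∷ z ∷ []) (+-suc x y) ⟩
  x + y ∷ suc (x + y) ∷ []                  ∎
  where open ≡-Reasoning
⊕-lab false false x y _ = refl

∣lab∣-⊔ : ∀ c d s x y → c ∧ d ≡ false → ∣ lab (c ∨ d) s ∣ ≡ ∣ lab c x ∣ ⊔ ∣ lab d y ∣
∣lab∣-⊔ true true s x y ()
∣lab∣-⊔ true false s x y _ = refl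
∣lab∣-⊔ false true s x y _ = refl
∣lab∣-⊔ false false s x y _ = refl

increasing⇒monotone : (g : ℕ → ℕ) → (∀ j → g j < g (suc j)) → ∀ {i j} → i < j → g i < g j
increasing⇒monotone g increasing {i} {suc j} (s≤s i≤j) with m≤n⇒m<n∨m≡n i≤j
... | inj₁ i<j = <-trans (increasing⇒monotone g increasing i<j) (increasing j)
... | inj₂ refl = increasing j

increasing⇒injective : (g : ℕ → ℕ) → (∀ j → g j < g (suc j)) → ∀ {i j} → g i ≡ g j → i ≡ j
increasing⇒injective g increasing {i} {j} gi≡gj with <-cmp i j
... | tri< i<j _ _ = ⊥-elim (<⇒≢ (increasing⇒monotone g increasing i<j) gi≡gj)
... | tri≈ _ i≡j _ = i≡j
... | tri> _ _ j<i = ⊥-elim (<⇒≢ (increasing⇒monotone g increasing j<i) (sym gi≡gj))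

weight : ℕ → ℕ
weight zero = 1
weight (suc j) = 2 * suc j

weight-increasing : ∀ j → weight j < weight (suc j)
weight-increasing zero = s≤s (s≤s z≤n)
weight-increasing (suc j) = *-monoʳ-< 2 (n<1+n (suc j))

consecutive-sum : ℕ → ℕ
consecutive-sum j = weight j + weight (suc j)

consecutive-sum-increasing : ∀ j → consecutive-sum j < consecutive-sum (suc j)
consecutive-sum-increasing j = +-mono-< (weight-increasing j) (weight-increasing (suc j))

-- For k ≥ 2 the sum weight k + weight 0 = 2k + 1 is no consecutive sum:
-- it exceeds consecutive-sum 0 = 3, and all later consecutive sums are even.
closing-sum-new : ∀ k → 2 ≤ k → ∀ j → weight k + weight 0 ≢ consecutive-sum j
closing-sum-new (suc k) 2≤k zero closing≡3 =
  <⇒≢ (≤-trans (n≤1+n 4) (+-monoˡ-≤ 1 (*-monoʳ-≤ 2 2≤k))) (sym closing≡3)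
closing-sum-new (suc k) _ (suc j) closing≡even = even≢odd (suc j + suc (suc j)) (suc k) (begin
  2 * (suc j + suc (suc j))           ≡⟨ *-distribˡ-+ 2 (suc j) (suc (suc j)) ⟩
  consecutive-sum (suc j)             ≡⟨ closing≡even ⟨
  2 * suc k + 1                       ≡⟨ +-comm (2 * suc k) 1 ⟩
  suc (2 * suc k)                     ∎)
  where open ≡-Reasoning

-- The graph C_n ∪ P_m with n = k + 1 ≥ 3 and m = m' + 1.  Its vertices are
-- numbered 0, …, n - 1 on the cycle and n, …, n + m - 1 on the path.
module CycleAndPath (k m' : ℕ) (2≤k : 2 ≤ k) where
  n m : ℕ
  n = suc k
  m = suc m'

  G : Graph
  G = Cycle n ∪ Path m

  EdgeShape : ℕ → Fin (n + m) × Fin (n + m) → Set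
  EdgeShape j e = toℕ (proj₁ e) ≡ j × (j < n × toℕ (proj₂ e) ≡ suc j % n ⊎ n ≤ j × toℕ (proj₂ e) ≡ suc j)

  cycle-part path-part : List (Fin (n + m) × Fin (n + m))
  cycle-part = map (λ e → (proj₁ e ↑ˡ m) , (proj₂ e ↑ˡ m)) (cycleEdges n)
  path-part = map (λ e → (n ↑ʳ proj₁ e) , (n ↑ʳ proj₂ e)) (pathEdges m)

  length-cycle-part : length cycle-part ≡ n
  length-cycle-part = trans (length-map _ (cycleEdges n)) (trans (length-map _ (allFin n)) (length-tabulate id))

  cycle-part-shaped : AtPositions EdgeShape 0 cycle-part
  cycle-part-shaped = atPositions-map _ (cycleEdges n) (atPositions-map _ (allFin n) (atPositions-tabulate id λ i →
    toℕ-↑ˡ i m , inj₁ (toℕ<n i , trans (toℕ-↑ˡ _ m) (toℕ-fromℕ< _))))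

  path-part-shaped : AtPositions EdgeShape n path-part
  path-part-shaped = atPositions-map _ (pathEdges m) (atPositions-map _ (allFin m') (atPositions-tabulate id λ i →
    trans (toℕ-↑ʳ n (inject₁ i)) (cong (n +_) (toℕ-inject₁ i)) ,
    inj₂ (m≤m+n n (toℕ i) , trans (toℕ-↑ʳ n (Fin.suc i)) (+-suc n (toℕ i)))))

  edge-shape : ∀ i → EdgeShape (toℕ i) (edge G i)
  edge-shape = lookup-atPositions (edges G) (atPositions-++ cycle-part cycle-part-shaped
    (subst (λ o → AtPositions EdgeShape o path-part) (sym length-cycle-part) path-part-shaped))

  n≤#edges : n ≤ length (edges G)
  n≤#edges = subst (_≤ length (edges G)) length-cycle-part
    (subst (length cycle-part ≤_) (sym (length-++ cycle-part)) (m≤m+n _ _))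

  cycle-walk : ℕ → Fin (n + m)
  cycle-walk j = (j mod n) ↑ˡ m

  toℕ-cycle-walk : ∀ j → toℕ (cycle-walk j) ≡ j % n
  toℕ-cycle-walk j = trans (toℕ-↑ˡ (j mod n) m) (toℕ-fromℕ< _)

  cycle-walk-closed : cycle-walk n ≡ cycle-walk 0
  cycle-walk-closed = toℕ-injective (trans (toℕ-cycle-walk n) (trans (n%n≡0 n) (sym (toℕ-cycle-walk 0))))

  cycle-walk-joined : ∀ j → j < n → Joins G (cycle-walk j) (cycle-walk (suc j))
  cycle-walk-joined j j<n = i , toℕ-injective src-at-j , toℕ-injective tgt-at-sj
    where
    i : Fin (length (edges G))
    i = fromℕ< (≤-trans j<n n≤#edges)
    toℕ-i : toℕ i ≡ j
    toℕ-i = toℕ-fromℕ< _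
    src-at-j : toℕ (src G i) ≡ toℕ (cycle-walk j)
    src-at-j = trans (proj₁ (edge-shape i)) (trans toℕ-i (sym (trans (toℕ-cycle-walk j) (m<n⇒m%n≡m j<n))))
    tgt-at-sj : toℕ (tgt G i) ≡ toℕ (cycle-walk (suc j))
    tgt-at-sj with proj₂ (edge-shape i)
    ... | inj₁ (_ , tgt≡) = trans tgt≡ (trans (cong (λ p → suc p % n) toℕ-i) (sym (toℕ-cycle-walk (suc j))))
    ... | inj₂ (n≤i , _) = ⊥-elim (<⇒≱ j<n (subst (n ≤_) toℕ-i n≤i))

  odd-cycle⇒1≤monoEdges : odd n ≡ true → ∀ f → WeakIASI G f → 1 ≤ monoEdges G f
  odd-cycle⇒1≤monoEdges oddN f weakIASI = forced-mono-edge⇒1≤monoEdges G f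
    (odd-closed-walk-forces-mono-edge weakIASI cycle-walk n oddN cycle-walk-closed cycle-walk-joined)

  edge-ends : ∀ i → toℕ (src G i) ≡ toℕ i × (toℕ (tgt G i) ≡ suc (toℕ i) ⊎ toℕ i ≡ k × toℕ (tgt G i) ≡ 0)
  edge-ends i with edge-shape i
  ... | src≡i , inj₂ (_ , tgt≡1+i) = src≡i , inj₁ tgt≡1+i
  ... | src≡i , inj₁ (i<n , tgt≡[1+i]%n) with m≤n⇒m<n∨m≡n i<n
  ...   | inj₁ 1+i<n = src≡i , inj₁ (trans tgt≡[1+i]%n (m<n⇒m%n≡m 1+i<n))
  ...   | inj₂ 1+i≡n = src≡i , inj₂ (suc-injective 1+i≡n , trans tgt≡[1+i]%n (trans (cong (_% n) 1+i≡n) (n%n≡0 n)))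

  f₀ : Fin (n + m) → Label
  f₀ v = lab (odd (toℕ v)) (weight (toℕ v))

  odd-src odd-tgt : Fin (length (edges G)) → Bool
  odd-src i = odd (toℕ (src G i))
  odd-tgt i = odd (toℕ (tgt G i))

  -- Consecutive vertices have opposite parity and vertex 0 is even, so no edge
  -- joins two pair-labelled vertices.
  ends-not-both-pairs : ∀ i → odd-src i ∧ odd-tgt i ≡ false
  ends-not-both-pairs i with edge-ends i
  ... | src≡i , inj₁ tgt≡1+i = trans (cong₂ (λ a b → odd a ∧ odd b) src≡i tgt≡1+i) (∧-inverseʳ (odd (toℕ i)))
  ... | _ , inj₂ (_ , tgt≡0) = trans (cong (odd-src i ∧_) (cong odd tgt≡0)) (∧-zeroʳ (odd-src i))

  edge-sum : Fin (length (edges G)) → ℕ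
  edge-sum i = weight (toℕ (src G i)) + weight (toℕ (tgt G i))

  edge-label : ∀ i → gf G f₀ i ≡ lab (odd-src i ∨ odd-tgt i) (edge-sum i)
  edge-label i = ⊕-lab (odd-src i) (odd-tgt i) (weight (toℕ (src G i))) (weight (toℕ (tgt G i))) (ends-not-both-pairs i)

  edge-sum-shape : ∀ i → edge-sum i ≡ consecutive-sum (toℕ i) ⊎ toℕ i ≡ k × edge-sum i ≡ weight k + weight 0
  edge-sum-shape i with edge-ends i
  ... | src≡i , inj₁ tgt≡1+i = inj₁ (cong₂ (λ a b → weight a + weight b) src≡i tgt≡1+i)
  ... | src≡i , inj₂ (i≡k , tgt≡0) = inj₂ (i≡k , cong₂ (λ a b → weight a + weight b) (trans src≡i i≡k) tgt≡0)

  edge-sum-injective : ∀ i j → edge-sum i ≡ edge-sum j → toℕ i ≡ toℕ j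
  edge-sum-injective i j same with edge-sum-shape i | edge-sum-shape j
  ... | inj₁ sum-i | inj₁ sum-j =
    increasing⇒injective consecutive-sum consecutive-sum-increasing (trans (sym sum-i) (trans same sum-j))
  ... | inj₂ (i≡k , _) | inj₂ (j≡k , _) = trans i≡k (sym j≡k)
  ... | inj₁ sum-i | inj₂ (_ , sum-j) = ⊥-elim (closing-sum-new k 2≤k (toℕ i) (trans (sym sum-j) (trans (sym same) sum-i)))
  ... | inj₂ (_ , sum-i) | inj₁ sum-j = ⊥-elim (closing-sum-new k 2≤k (toℕ j) (trans (sym sum-i) (trans same sum-j)))

  -- f₀ is a weak IASI: labels are separated by their least elements, and so are
  -- edge labels, which moreover have the cardinality of the larger end label
  f₀-weak : WeakIASI G f₀
  f₀-weak = record
    { iasi = record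
      { nonempty = λ _ → lab-nonempty _ _
      ; finiteSet = λ _ → lab-unique _ _
      ; f-inj = λ u v same → toℕ-injective (increasing⇒injective weight weight-increasing (lab-≋⇒base≡ same))
      ; g-inj = λ i j same →
          toℕ-injective (edge-sum-injective i j (lab-≋⇒base≡ (subst₂ _≋_ (edge-label i) (edge-label j) same)))
      }
    ; weak = λ i → trans (cong ∣_∣ (edge-label i)) (∣lab∣-⊔ (odd-src i) (odd-tgt i) _ _ _ (ends-not-both-pairs i))
    }

  -- Under f₀ only the closing edge can be mono-indexed, and only when n is odd:
  -- every other edge has an odd end, and the closing edge joins k to 0.
  f₀-mono-edge-is-closing : ∀ i → Mono (gf G f₀ i) → toℕ i ≡ k × odd n ≡ true
  f₀-mono-edge-is-closing i mono with lab-mono⇒false _ _ (subst Mono (edge-label i) mono) | edge-ends i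
  ... | no-odd-end | src≡i , inj₁ tgt≡1+i = ⊥-elim (not-¬ refl (begin
    true                            ≡⟨ ∨-inverseʳ (odd (toℕ i)) ⟨
    odd (toℕ i) ∨ odd (suc (toℕ i)) ≡⟨ cong₂ (λ a b → odd a ∨ odd b) src≡i tgt≡1+i ⟨
    odd-src i ∨ odd-tgt i           ≡⟨ no-odd-end ⟩
    false                           ∎))
    where open ≡-Reasoning
  ... | no-odd-end | src≡i , inj₂ (i≡k , tgt≡0) = i≡k , cong not (begin
    odd k                           ≡⟨ ∨-identityʳ (odd k) ⟨
    odd k ∨ odd 0                   ≡⟨ cong₂ (λ a b → odd a ∨ odd b) (trans src≡i i≡k) tgt≡0 ⟨
    odd-src i ∨ odd-tgt i           ≡⟨ no-odd-end ⟩
    false                           ∎)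
    where open ≡-Reasoning

  even-cycle⇒sparing-0 : odd n ≡ false → SparingNumber G 0
  even-cycle⇒sparing-0 evenN = (f₀ , f₀-weak , no-mono-edge⇒monoEdges≡0 G f₀ no-mono-edge) , λ _ _ → z≤n
    where
    no-mono-edge : ∀ i → ¬ Mono (gf G f₀ i)
    no-mono-edge i mono = not-¬ refl (trans (sym (proj₂ (f₀-mono-edge-is-closing i mono))) evenN)

  odd-cycle⇒sparing-1 : odd n ≡ true → SparingNumber G 1
  odd-cycle⇒sparing-1 oddN = (f₀ , f₀-weak , ≤-antisym at-most-one (odd-cycle⇒1≤monoEdges oddN f₀ f₀-weak))
                           , odd-cycle⇒1≤monoEdges oddN
    where
    at-most-one : monoEdges G f₀ ≤ 1
    at-most-one = mono-edges-at-one-position⇒monoEdges≤1 G f₀ k (λ i → proj₁ ∘ f₀-mono-edge-is-closing i)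

-- Lemma 2.2: split on the parity of n.
lemma2p2 : (n m : ℕ) → 3 ≤ n → 2 ≤ m → AdmitsWeakIASI (Cycle n)
    → SparingNumber (Cycle n ∪ Path m) 0 ⊎ SparingNumber (Cycle n ∪ Path m) 1
lemma2p2 (suc k) (suc m') (s≤s 2≤k) _ _ with odd (suc k) in parity
... | false = inj₁ (even-cycle⇒sparing-0 parity)
  where open CycleAndPath k m' 2≤k
... | true = inj₂ (odd-cycle⇒sparing-1 parity)
  where open CycleAndPath k m' 2≤k
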